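{- For any integer $k\ge3$ and any $I=(a_1,\dots,a_n)\in(0,1]^n$ with $n\le k$ and $\sum_{i=1}^n a_i\le1$, we have $w_2(I)\le\lambda_k-\frac1k$.
   Context: Define $\pi_1=2$, $\pi_{i+1}=\pi_i(\pi_i-1)+1$ for $i\ge1$, and $\lambda_j=\sum_{i=1}^{j}\max\{\frac{1}{\pi_i-1},\frac1j\}$ for $j\ge1$. For fixed $k\ge3$, the weight function $w_2:(0,1]\to\mathbb{R}$ is $w_2(x)=1-\frac1k$ if $x\in(\frac12,1]$; $w_2(x)=\frac1j$ if $x\in(\frac1{j+1},\frac1j]$ for $j=2,\dots,k-1$; $w_2(x)=\frac1k$ if $x\in(0,\frac1k]$. For $I=(a_1,\dots,a_n)$, $w_2(I)=\sum_{i=1}^n w_2(a_i)$.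
   Formalization: The entries $a_i$ of I are rational numbers in (0,1] rather than real ones. -}

module Defs where

open import Data.Nat as ℕ using (ℕ; zero; suc; _∸_)
open import Data.Integer using (+_)
open import Data.Rational using (ℚ; _/_; 0ℚ; 1ℚ; _+_; _-_; _⊔_; _≤_; _<_)
open import Data.Rational.Properties using (_≤?_; _<?_)
open import Data.List using (List; []; _∷_; map; upTo; foldr)
open import Data.Bool using (Bool; if_then_else_; _∧_)
open import Relation.Nullary using (does)

-- 1/n as a rational (n ≥ 1 in every use below; inv 0 = 0 is junk)
inv : ℕ → ℚ
inv zero    = 0ℚ
inv (suc n) = + 1 / suc n

-- Sylvester's sequence, 1-indexed: π 1 = 2, π (i+1) = π i (π i - 1) + 1.
-- (π 0 = 2 is a junk value, never used.)
π : ℕ → ℕ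
π zero = 2
π (suc zero) = 2
π (suc (suc i)) = π (suc i) ℕ.* (π (suc i) ∸ 1) ℕ.+ 1

sumℚ : List ℚ → ℚ
sumℚ = foldr _+_ 0ℚ

oneTo : ℕ → List ℕ
oneTo j = map suc (upTo j)

λ' : ℕ → ℚ
λ' j = sumℚ (map (λ i → inv (π i ∸ 1) ⊔ inv j) (oneTo j))

inInterval : ℕ → ℚ → Bool
inInterval j x = does (inv (suc j) <? x) ∧ does (x ≤? inv j)

-- search j = 2, ..., k-1 for the interval (1/(j+1), 1/j] containing x;
-- if none, the remaining case is x ∈ (0, 1/k] with weight 1/k.
searchW : ℕ → ℚ → List ℕ → ℚ
searchW k x []       = inv k
searchW k x (j ∷ js) = if inInterval j x then inv j else searchW k x js

twoTo : ℕ → List ℕ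
twoTo k = map (λ m → suc (suc m)) (upTo (k ∸ 2))

w₂ : ℕ → ℚ → ℚ
w₂ k x = if does (inv 2 <? x) then 1ℚ - inv k else searchW k x (twoTo k)

w₂List : ℕ → List ℚ → ℚ
w₂List k I = sumℚ (map (w₂ k) I)

{-# OPTIONS --safe #-}
-- Write Λ k n q for the sum of max(1/q_i, 1/k) over i < n, along q_0 = q and
-- q_(i+1) = q_i (q_i + 1); since π_(i+1) - 1 = (π_i - 1) π_i, λ_k = Λ k k 1.
-- For q ≥ 2, at most n items of total size ≤ 1/q have weight ≤ Λ k n q, by induction on n.
-- An item larger than 1/(q+1) lies in (1/(q+1), 1/q], has weight ≤ max(1/q, 1/k), and leaves
-- less than 1/q - 1/(q+1) = 1/(q(q+1)) for the others.  If every item is at most 1/(q+1),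
-- then 1/j = (1 + 1/j)/(j+1) bounds each weight by max(1/k, (1 + 1/(q+1)) a), and it remains
-- to count the items whose weight exceeds 1/k.  For the theorem itself, an item above 1/2
-- has weight 1 - 1/k and the rest is handled at q = 2; otherwise every weight is at most
-- 1/2 and at most max(1/k, 3a/2), which gives 3/2 + (k-3)/k ≤ λ_k - 1/k.
module Submission where

open import Defs
open import Data.Nat using (ℕ)
open import Data.Rational using (ℚ; 0ℚ; 1ℚ; _≤_; _<_; _-_)
open import Data.List using (List; length)
open import Data.List.Relation.Unary.All using (All)
open import Data.Product using (_×_)

open import Data.Nat as ℕ using (zero; suc; _∸_; z≤n; s≤s)
import Data.Nat.Properties as ℕ
open import Data.Nat.Coprimality using (1-coprimeTo)
open import Data.Integer as ℤ using ()
import Data.Integer.Properties as ℤ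
open import Data.Rational using (mkℚ; _+_; _*_; -_; _⊔_; 1/_; *≤*; nonNegative)
open import Data.Rational.Properties
import Data.Rational.Unnormalised as ℚᵘ
import Data.Rational.Unnormalised.Properties as ℚᵘ
open import Data.Rational.Solver using (module +-*-Solver)
open import Algebra.Bundles using (CommutativeRing)
open import Algebra.Properties.Semiring.Mult (CommutativeRing.semiring +-*-commutativeRing)
  using (×-homo-+; ×1-homo-*) renaming (_×_ to infixr 8 _·_)
open import Data.List using ([]; _∷_; map; applyUpTo; upTo)
open import Data.List.Relation.Unary.All as All using ([]; _∷_)
open import Data.List.Relation.Unary.All.Properties using (¬Any⇒All¬)
open import Data.List.Relation.Unary.Any using (Any; here; there; any?)
open import Data.List.Relation.Binary.Permutation.Propositional
  using (_↭_; ↭-refl; ↭-prep; ↭-swap; ↭-trans; ↭⇒↭ₛ)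
open import Data.List.Relation.Binary.Permutation.Propositional.Properties
  using (map⁺; ↭-length; All-resp-↭)
open import Data.List.Relation.Binary.Permutation.Setoid.Properties ≡-setoid
  using (foldr-commMonoid)
open import Data.Product using (_,_; proj₁; ∃₂)
open import Data.Sum using (_⊎_; inj₁; inj₂)
open import Data.Bool using (if_then_else_; _∧_)
open import Function using (id)
open import Relation.Nullary using (Dec; yes; no; does; ¬_; contradiction)
open import Relation.Nullary.Decidable using (dec-true; dec-false)
open import Relation.Binary.PropositionalEquality
  using (_≡_; refl; sym; trans; cong; cong₂; subst; subst₂; module ≡-Reasoning)

open +-*-Solver

ι : ℕ → ℚ
ι n = n · 1ℚ

-- The normal form of inv (suc m), on which 1/_ and *≤* compute.
unitFraction : ℕ → ℚ
unitFraction m = mkℚ (ℤ.+ 1) m (1-coprimeTo (suc m))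

inv≡unitFraction : ∀ m → inv (suc m) ≡ unitFraction m
inv≡unitFraction m = normalize-coprime (1-coprimeTo (suc m))

ι≡1/unitFraction : ∀ m → ι (suc m) ≡ 1/ unitFraction m
ι≡1/unitFraction zero    = refl
ι≡1/unitFraction (suc m) = begin
  1ℚ + ι (suc m)          ≡⟨ cong (λ t → 1ℚ + t) (ι≡1/unitFraction m) ⟩
  1ℚ + 1/ unitFraction m  ≡⟨ toℚᵘ-injective
                               (ℚᵘ.≃-trans (toℚᵘ-homo-+ 1ℚ (1/ unitFraction m)) (ℚᵘ.*≡* eq)) ⟩
  1/ unitFraction (suc m) ∎
  where
  open ≡-Reasoning
  eq : (ℤ.1ℤ ℤ.* ℤ.1ℤ ℤ.+ ℤ.+ suc m ℤ.* ℤ.1ℤ) ℤ.* ℤ.1ℤ ≡ ℤ.+ suc (suc m) ℤ.* ℤ.1ℤ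
  eq = cong (λ t → (ℤ.1ℤ ℤ.+ t) ℤ.* ℤ.1ℤ) (ℤ.*-identityʳ (ℤ.+ suc m))

inv-*-ι : ∀ m → inv (suc m) * ι (suc m) ≡ 1ℚ
inv-*-ι m rewrite inv≡unitFraction m | ι≡1/unitFraction m = *-inverseʳ (unitFraction m)

inv-unique : ∀ {x} m → x * ι (suc m) ≡ 1ℚ → x ≡ inv (suc m)
inv-unique {x} m x*ι≡1 = begin
  x                              ≡⟨ sym (*-identityʳ x) ⟩
  x * 1ℚ                         ≡⟨ cong (x *_) (sym (trans (*-comm (ι (suc m)) (inv (suc m))) (inv-*-ι m))) ⟩
  x * (ι (suc m) * inv (suc m))  ≡⟨ sym (*-assoc x (ι (suc m)) (inv (suc m))) ⟩
  x * ι (suc m) * inv (suc m)    ≡⟨ cong (_* inv (suc m)) x*ι≡1 ⟩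
  1ℚ * inv (suc m)               ≡⟨ *-identityˡ (inv (suc m)) ⟩
  inv (suc m)                    ∎
  where open ≡-Reasoning

inv-homo-* : ∀ a b → inv (suc a ℕ.* suc b) ≡ inv (suc a) * inv (suc b)
inv-homo-* a b = sym (inv-unique (b ℕ.+ a ℕ.* suc b) (begin
  u * v * ι (suc a ℕ.* suc b)  ≡⟨ cong (u * v *_) (×1-homo-* (suc a) (suc b)) ⟩
  u * v * (x * y)              ≡⟨ solve 4 (λ u v x y → u :* v :* (x :* y) := u :* x :* (v :* y)) refl u v x y ⟩
  u * x * (v * y)              ≡⟨ cong₂ _*_ (inv-*-ι a) (inv-*-ι b) ⟩
  1ℚ * 1ℚ                      ≡⟨⟩
  1ℚ                           ∎))
  where
  open ≡-Reasoning
  u = inv (suc a)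
  v = inv (suc b)
  x = ι (suc a)
  y = ι (suc b)

[1+inv]*inv-suc≡inv : ∀ m → (1ℚ + inv (suc m)) * inv (suc (suc m)) ≡ inv (suc m)
[1+inv]*inv-suc≡inv m = inv-unique m (begin
  (1ℚ + u) * v * x    ≡⟨ solve 3 (λ u v x → (con 1ℚ :+ u) :* v :* x := v :* (u :* x :+ x)) refl u v x ⟩
  v * (u * x + x)     ≡⟨ cong (λ t → v * (t + x)) (inv-*-ι m) ⟩
  v * ι (suc (suc m)) ≡⟨ inv-*-ι (suc m) ⟩
  1ℚ                  ∎)
  where
  open ≡-Reasoning
  u = inv (suc m)
  v = inv (suc (suc m))
  x = ι (suc m)

inv-split : ∀ m → inv (suc m) ≡ inv (suc (suc m)) + inv (suc m ℕ.* suc (suc m))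
inv-split m = begin
  inv (suc m)               ≡⟨ sym ([1+inv]*inv-suc≡inv m) ⟩
  (1ℚ + u) * v              ≡⟨ solve 2 (λ u v → (con 1ℚ :+ u) :* v := v :+ u :* v) refl u v ⟩
  v + u * v                 ≡⟨ cong (v +_) (sym (inv-homo-* m (suc m))) ⟩
  v + inv (suc m ℕ.* suc (suc m)) ∎
  where
  open ≡-Reasoning
  u = inv (suc m)
  v = inv (suc (suc m))

[1+inv-suc]*inv≡inv+inv[*suc] : ∀ m →
  (1ℚ + inv (suc (suc m))) * inv (suc m) ≡ inv (suc m) + inv (suc m ℕ.* suc (suc m))
[1+inv-suc]*inv≡inv+inv[*suc] m = begin
  (1ℚ + v) * u  ≡⟨ solve 2 (λ u v → (con 1ℚ :+ v) :* u := u :+ u :* v) refl u v ⟩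
  u + u * v     ≡⟨ cong (u +_) (sym (inv-homo-* m (suc m))) ⟩
  u + inv (suc m ℕ.* suc (suc m)) ∎
  where
  open ≡-Reasoning
  u = inv (suc m)
  v = inv (suc (suc m))

inv-antimono-≤ : ∀ {m n} → m ℕ.≤ n → inv (suc n) ≤ inv (suc m)
inv-antimono-≤ {m} {n} m≤n rewrite inv≡unitFraction m | inv≡unitFraction n =
  *≤* (subst₂ ℤ._≤_ (sym (ℤ.*-identityˡ (ℤ.+ suc m))) (sym (ℤ.*-identityˡ (ℤ.+ suc n)))
                    (ℤ.+≤+ (s≤s m≤n)))

inv-nonNeg : ∀ n → 0ℚ ≤ inv n
inv-nonNeg zero    = ≤-refl
inv-nonNeg (suc n) rewrite inv≡unitFraction n = *≤* (ℤ.+≤+ z≤n)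

inv-cancel-< : ∀ {m n} → inv (suc m) < inv n → n ℕ.≤ m
inv-cancel-< {m} {zero}  _ = z≤n
inv-cancel-< {m} {suc n} 1/m+1<1/n+1 with suc n ℕ.≤? m
... | yes n<m = n<m
... | no  n≮m = contradiction (<-≤-trans 1/m+1<1/n+1 (inv-antimono-≤ (ℕ.≮⇒≥ n≮m))) (<-irrefl refl)

1+inv-nonNeg : ∀ n → 0ℚ ≤ 1ℚ + inv n
1+inv-nonNeg n = +-mono-≤ (nonNegative⁻¹ 1ℚ) (inv-nonNeg n)

p≤p+q : ∀ {p q} → 0ℚ ≤ q → p ≤ p + q
p≤p+q {p} {q} 0≤q = ≤-trans (≤-reflexive (sym (+-identityʳ p))) (+-monoʳ-≤ p 0≤q)

p≤q+p : ∀ {p q} → 0ℚ ≤ q → p ≤ q + p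
p≤q+p {p} {q} 0≤q = ≤-trans (≤-reflexive (sym (+-identityˡ p))) (+-monoˡ-≤ p 0≤q)

cancel-+-≤ : ∀ {x y u v} → u ≤ x → x + y ≤ u + v → y ≤ v
cancel-+-≤ {x} {y} {u} {v} u≤x x+y≤u+v with y ≤? v
... | yes y≤v = y≤v
... | no  y≰v = contradiction (≤-<-trans x+y≤u+v (+-mono-≤-< u≤x (≰⇒> y≰v))) (<-irrefl refl)

if-∧-≤ : ∀ {P Q : Set} {A C B : ℚ} (p? : Dec P) (q? : Dec Q) →
  (P → Q → A ≤ B) → C ≤ B → (if does p? ∧ does q? then A else C) ≤ B
if-∧-≤ (yes p) (yes q) A≤B _   = A≤B p q
if-∧-≤ (yes _) (no _)  _   C≤B = C≤B
if-∧-≤ (no _)  _       _   C≤B = C≤B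

SlotBound : ℚ → ℚ → Set
SlotBound x B = ∀ j → 2 ℕ.≤ j → inv (suc j) < x → x ≤ inv j → inv j ≤ B

searchW-≤ : ∀ k x {B} ms → SlotBound x B → inv k ≤ B → searchW k x (map (λ m → suc (suc m)) ms) ≤ B
searchW-≤ k x []       _     1/k≤B = 1/k≤B
searchW-≤ k x (m ∷ ms) slots 1/k≤B =
  if-∧-≤ (inv (suc (suc (suc m))) <? x) (x ≤? inv (suc (suc m)))
    (slots (suc (suc m)) (s≤s (s≤s z≤n))) (searchW-≤ k x ms slots 1/k≤B)

w₂-big : ∀ k {x} → inv 2 < x → w₂ k x ≡ 1ℚ - inv k
w₂-big k {x} 1/2<x = cong (if_then 1ℚ - inv k else searchW k x (twoTo k)) (dec-true (inv 2 <? x) 1/2<x)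

w₂-≤ : ∀ k {x B} → ¬ (inv 2 < x) → SlotBound x B → inv k ≤ B → w₂ k x ≤ B
w₂-≤ k {x} {B} x≯1/2 slots 1/k≤B =
  subst (_≤ B) (cong (if_then 1ℚ - inv k else searchW k x (twoTo k)) (sym (dec-false (inv 2 <? x) x≯1/2)))
    (searchW-≤ k x (upTo (k ∸ 2)) slots 1/k≤B)

w₂-≤-tiny : ∀ k {q a} → 1 ℕ.≤ q → a ≤ inv (suc q) → w₂ k a ≤ inv k ⊔ (1ℚ + inv (suc q)) * a
w₂-≤-tiny k {q} {a} q≥1 a≤1/q+1 = w₂-≤ k a≯1/2 slots (p≤p⊔q (inv k) _)
  where
  a≯1/2 : ¬ (inv 2 < a)
  a≯1/2 1/2<a = <-irrefl refl (<-≤-trans 1/2<a (≤-trans a≤1/q+1 (inv-antimono-≤ q≥1)))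
  slots : SlotBound a (inv k ⊔ (1ℚ + inv (suc q)) * a)
  slots zero    ()
  slots (suc j) _  lo _ = p≤q⇒p≤r⊔q (inv k) (begin
    inv (suc j)                                 ≡⟨ sym ([1+inv]*inv-suc≡inv j) ⟩
    (1ℚ + inv (suc j)) * inv (suc (suc j))  ≤⟨ *-monoʳ-≤-nonNeg (inv (suc (suc j)))
                                                 {{nonNegative (inv-nonNeg (suc (suc j)))}}
                                                 (+-monoʳ-≤ 1ℚ (inv-antimono-≤ q≤j)) ⟩
    (1ℚ + inv (suc q)) * inv (suc (suc j))  ≤⟨ *-monoˡ-≤-nonNeg (1ℚ + inv (suc q))
                                                 {{nonNegative (1+inv-nonNeg (suc q))}} (<⇒≤ lo) ⟩
    (1ℚ + inv (suc q)) * a                      ∎)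
    where
    open ≤-Reasoning
    q≤j : q ℕ.≤ j
    q≤j = ℕ.s≤s⁻¹ (inv-cancel-< {suc j} {suc q} (<-≤-trans lo a≤1/q+1))

w₂-≤-slot : ∀ k {q a} → 2 ℕ.≤ q → inv (suc q) < a → a ≤ inv q → w₂ k a ≤ inv q ⊔ inv k
w₂-≤-slot k {suc q} {a} (s≤s q≥1) lo hi = w₂-≤ k a≯1/2 slots (p≤q⊔p (inv (suc q)) (inv k))
  where
  a≯1/2 : ¬ (inv 2 < a)
  a≯1/2 1/2<a = <-irrefl refl (<-≤-trans 1/2<a (≤-trans hi (inv-antimono-≤ q≥1)))
  slots : SlotBound a (inv (suc q) ⊔ inv k)
  slots zero    ()
  slots (suc j) _  lo′ _ =
    p≤q⇒p≤q⊔r (inv k) (inv-antimono-≤ (ℕ.s≤s⁻¹ (inv-cancel-< {suc j} {suc q} (<-≤-trans lo′ hi))))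

w₂-≤-half : ∀ k {a} → 2 ℕ.≤ k → ¬ (inv 2 < a) → w₂ k a ≤ inv 2
w₂-≤-half (suc k) (s≤s k≥1) a≯1/2 = w₂-≤ (suc k) a≯1/2 slots (inv-antimono-≤ k≥1)
  where
  slots : SlotBound _ (inv 2)
  slots zero    ()
  slots (suc j) (s≤s j≥1) _ _ = inv-antimono-≤ j≥1

sumℚ-↭ : ∀ {xs ys} → xs ↭ ys → sumℚ xs ≡ sumℚ ys
sumℚ-↭ σ = foldr-commMonoid +-0-isCommutativeMonoid (↭⇒↭ₛ σ)

sumℚ-nonNeg : ∀ {xs} → All (0ℚ ≤_) xs → 0ℚ ≤ sumℚ xs
sumℚ-nonNeg []         = ≤-refl
sumℚ-nonNeg (0≤x ∷ ps) = +-mono-≤ 0≤x (sumℚ-nonNeg ps)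

extract : ∀ {A : Set} {P : A → Set} {xs} → Any P xs → ∃₂ λ a ys → P a × xs ↭ a ∷ ys
extract (here pa) = _ , _ , pa , ↭-refl
extract {xs = x ∷ _} (there pxs) with a , ys , pa , σ ← extract pxs =
  a , x ∷ ys , pa , ↭-trans (↭-prep x σ) (↭-swap x a ↭-refl)

≤⊔-cases : ∀ {w e y} → w ≤ e ⊔ y → w ≤ e ⊎ w ≤ y
≤⊔-cases {w} {e} {y} w≤e⊔y with ⊔-sel e y
... | inj₁ e⊔y≡e = inj₁ (subst (w ≤_) e⊔y≡e w≤e⊔y)
... | inj₂ e⊔y≡y = inj₂ (subst (w ≤_) e⊔y≡y w≤e⊔y)

⊔-classify : ∀ {w e y c} → w ≤ e ⊔ y → w ≤ e ⊔ c → w ≤ e ⊎ (w ≤ y × w ≤ c)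
⊔-classify w≤e⊔y w≤e⊔c with ≤⊔-cases w≤e⊔y | ≤⊔-cases w≤e⊔c
... | inj₁ w≤e | _        = inj₁ w≤e
... | inj₂ _   | inj₁ w≤e = inj₁ w≤e
... | inj₂ w≤y | inj₂ w≤c = inj₂ (w≤y , w≤c)

·-nonNeg : ∀ n {x} → 0ℚ ≤ x → 0ℚ ≤ n · x
·-nonNeg zero    _   = ≤-refl
·-nonNeg (suc n) 0≤x = +-mono-≤ 0≤x (·-nonNeg n 0≤x)

·-monoˡ-≤ : ∀ {m n x} → 0ℚ ≤ x → m ℕ.≤ n → m · x ≤ n · x
·-monoˡ-≤ {n = n} 0≤x z≤n     = ·-nonNeg n 0≤x
·-monoˡ-≤ {x = x} 0≤x (s≤s m≤n) = +-monoʳ-≤ x (·-monoˡ-≤ 0≤x m≤n)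

·-monoʳ-≤ : ∀ n {x y} → x ≤ y → n · x ≤ n · y
·-monoʳ-≤ zero    _   = ≤-refl
·-monoʳ-≤ (suc n) x≤y = +-mono-≤ x≤y (·-monoʳ-≤ n x≤y)

weight-split : ∀ (w : ℚ → ℚ) e r c → 0ℚ ≤ r → ∀ {xs} → All (0ℚ ≤_) xs →
  All (λ a → w a ≤ e ⊎ (w a ≤ r * a × w a ≤ c)) xs →
  ∃₂ λ M P → M ℕ.+ P ≡ length xs
           × sumℚ (map w xs) ≤ M · e + r * sumℚ xs
           × sumℚ (map w xs) ≤ M · e + P · c
weight-split w e r c 0≤r [] [] =
  0 , 0 , refl , ≤-reflexive (sym (trans (+-identityˡ (r * 0ℚ)) (*-zeroʳ r))) , ≤-refl
weight-split w e r c 0≤r {a ∷ xs} (0≤a ∷ 0≤xs) (wa≤ ∷ ws)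
  with M , P , M+P≡n , W≤Me+rS , W≤Me+Pc ← weight-split w e r c 0≤r 0≤xs ws
  with wa≤
... | inj₁ wa≤e = suc M , P , cong suc M+P≡n ,
  (begin
    w a + W                      ≤⟨ +-mono-≤ wa≤e W≤Me+rS ⟩
    e + (M · e + r * S)          ≤⟨ +-monoʳ-≤ e (+-monoʳ-≤ (M · e)
                                      (*-monoˡ-≤-nonNeg r {{nonNegative 0≤r}} (p≤q+p 0≤a))) ⟩
    e + (M · e + r * (a + S))    ≡⟨ sym (+-assoc e (M · e) (r * (a + S))) ⟩
    e + M · e + r * (a + S)      ∎) ,
  (begin
    w a + W                      ≤⟨ +-mono-≤ wa≤e W≤Me+Pc ⟩
    e + (M · e + P · c)          ≡⟨ sym (+-assoc e (M · e) (P · c)) ⟩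
    e + M · e + P · c            ∎)
  where
  open ≤-Reasoning
  W = sumℚ (map w xs)
  S = sumℚ xs
... | inj₂ (wa≤ra , wa≤c) = M , suc P , trans (ℕ.+-suc M P) (cong suc M+P≡n) ,
  (begin
    w a + W                      ≤⟨ +-mono-≤ wa≤ra W≤Me+rS ⟩
    r * a + (M · e + r * S)      ≡⟨ solve 4 (λ m r a s → r :* a :+ (m :+ r :* s) := m :+ r :* (a :+ s))
                                      refl (M · e) r a S ⟩
    M · e + r * (a + S)          ∎) ,
  (begin
    w a + W                      ≤⟨ +-mono-≤ wa≤c W≤Me+Pc ⟩
    c + (M · e + P · c)          ≡⟨ solve 3 (λ c m p → c :+ (m :+ p) := m :+ (c :+ p)) refl c (M · e) (P · c) ⟩
    M · e + (c + P · c)          ∎)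
  where
  open ≤-Reasoning
  W = sumℚ (map w xs)
  S = sumℚ xs

exchange-≤ : ∀ {M P} t m {e c} → M ℕ.+ P ℕ.≤ t ℕ.+ m → P ℕ.≤ t → 0ℚ ≤ e → e ≤ c →
  M · e + P · c ≤ t · c + m · e
exchange-≤ {M} t m {e} {c} M+0≤t+m z≤n 0≤e e≤c = begin
  M · e + 0ℚ       ≡⟨ +-identityʳ (M · e) ⟩
  M · e            ≤⟨ ·-monoˡ-≤ 0≤e (subst (ℕ._≤ t ℕ.+ m) (ℕ.+-identityʳ M) M+0≤t+m) ⟩
  (t ℕ.+ m) · e    ≡⟨ ×-homo-+ e t m ⟩
  t · e + m · e    ≤⟨ +-monoˡ-≤ (m · e) (·-monoʳ-≤ t e≤c) ⟩
  t · c + m · e    ∎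
  where open ≤-Reasoning
exchange-≤ {M} {suc P} (suc t) m {e} {c} M+P+1≤t+m+1 (s≤s P≤t) 0≤e e≤c = begin
  M · e + (c + P · c)   ≡⟨ solve 3 (λ x c y → x :+ (c :+ y) := c :+ (x :+ y)) refl (M · e) c (P · c) ⟩
  c + (M · e + P · c)   ≤⟨ +-monoʳ-≤ c (exchange-≤ t m M+P≤t+m P≤t 0≤e e≤c) ⟩
  c + (t · c + m · e)   ≡⟨ sym (+-assoc c (t · c) (m · e)) ⟩
  c + t · c + m · e     ∎
  where
  open ≤-Reasoning
  M+P≤t+m : M ℕ.+ P ℕ.≤ t ℕ.+ m
  M+P≤t+m = ℕ.s≤s⁻¹ (subst (ℕ._≤ suc t ℕ.+ m) (ℕ.+-suc M P) M+P+1≤t+m+1)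

Λ : ℕ → ℕ → ℕ → ℚ
Λ k zero    q = 0ℚ
Λ k (suc n) q = (inv q ⊔ inv k) + Λ k n (q ℕ.* suc q)

π-pos : ∀ i → 1 ℕ.≤ π i
π-pos zero          = s≤s z≤n
π-pos (suc zero)    = s≤s z≤n
π-pos (suc (suc i)) = ℕ.m≤n+m 1 (π (suc i) ℕ.* (π (suc i) ∸ 1))

π-pred-step : ∀ m → π (suc (suc m)) ∸ 1 ≡ (π (suc m) ∸ 1) ℕ.* suc (π (suc m) ∸ 1)
π-pred-step m = begin
  p ℕ.* (p ∸ 1) ℕ.+ 1 ∸ 1   ≡⟨ ℕ.m+n∸n≡m (p ℕ.* (p ∸ 1)) 1 ⟩
  p ℕ.* (p ∸ 1)             ≡⟨ ℕ.*-comm p (p ∸ 1) ⟩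
  (p ∸ 1) ℕ.* p             ≡⟨ cong ((p ∸ 1) ℕ.*_) (sym (ℕ.m∸n+n≡m 1≤p)) ⟩
  (p ∸ 1) ℕ.* (p ∸ 1 ℕ.+ 1) ≡⟨ cong ((p ∸ 1) ℕ.*_) (ℕ.+-comm (p ∸ 1) 1) ⟩
  (p ∸ 1) ℕ.* suc (p ∸ 1)   ∎
  where
  open ≡-Reasoning
  p = π (suc m)
  1≤p : 1 ℕ.≤ p
  1≤p = π-pos (suc m)

λ'-sum≡Λ : ∀ k n f → (∀ i → f (suc i) ≡ suc (f i)) →
  sumℚ (map (λ i → inv (π i ∸ 1) ⊔ inv k) (map suc (applyUpTo f n))) ≡ Λ k n (π (suc (f 0)) ∸ 1)
λ'-sum≡Λ k zero    f _    = refl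
λ'-sum≡Λ k (suc n) f f-consecutive = cong ((inv (π (suc (f 0)) ∸ 1) ⊔ inv k) +_) (begin
  sumℚ (map _ (map suc (applyUpTo (λ i → f (suc i)) n)))
    ≡⟨ λ'-sum≡Λ k n (λ i → f (suc i)) (λ i → f-consecutive (suc i)) ⟩
  Λ k n (π (suc (f 1)) ∸ 1)
    ≡⟨ cong (λ i → Λ k n (π (suc i) ∸ 1)) (f-consecutive 0) ⟩
  Λ k n (π (suc (suc (f 0))) ∸ 1)
    ≡⟨ cong (Λ k n) (π-pred-step (f 0)) ⟩
  Λ k n ((π (suc (f 0)) ∸ 1) ℕ.* suc (π (suc (f 0)) ∸ 1)) ∎)
  where open ≡-Reasoning

λ'≡Λ : ∀ k → λ' k ≡ Λ k k 1
λ'≡Λ k = λ'-sum≡Λ k k id (λ _ → refl)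

Λ-≥ : ∀ k n q → n · inv k ≤ Λ k n q
Λ-≥ k zero    q = ≤-refl
Λ-≥ k (suc n) q = +-mono-≤ (p≤q⊔p (inv q) (inv k)) (Λ-≥ k n (q ℕ.* suc q))

Λ-suc-≥ : ∀ k n q → n · inv k + inv q ≤ Λ k (suc n) q
Λ-suc-≥ k n q = begin
  n · inv k + inv q                      ≡⟨ +-comm (n · inv k) (inv q) ⟩
  inv q + n · inv k                      ≤⟨ +-mono-≤ (p≤p⊔q (inv q) (inv k)) (Λ-≥ k n (q ℕ.* suc q)) ⟩
  (inv q ⊔ inv k) + Λ k n (q ℕ.* suc q)  ∎
  where open ≤-Reasoning

Λ-2+-≥ : ∀ k n q → n · inv k + (inv q + inv (q ℕ.* suc q)) ≤ Λ k (suc (suc n)) q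
Λ-2+-≥ k n q = begin
  n · inv k + (inv q + inv Q)          ≡⟨ solve 3 (λ x u v → x :+ (u :+ v) := u :+ (x :+ v))
                                            refl (n · inv k) (inv q) (inv Q) ⟩
  inv q + (n · inv k + inv Q)          ≤⟨ +-mono-≤ (p≤p⊔q (inv q) (inv k)) (Λ-suc-≥ k n Q) ⟩
  (inv q ⊔ inv k) + Λ k (suc n) Q      ∎
  where
  open ≤-Reasoning
  Q = q ℕ.* suc q

-- By the number P of items not bounded by 1/k: none, and the count suffices; one, capped by
-- 1/(q+1); two or more, paid for by the total size as (1 + 1/(q+2))/(q+1) = 1/(q+1) + 1/((q+1)(q+2)).
split-≤-Λ : ∀ k n q {M P W S} → M ℕ.+ P ℕ.≤ n → S ≤ inv (suc q) →
  W ≤ M · inv k + (1ℚ + inv (suc (suc q))) * S →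
  W ≤ M · inv k + P · ((1ℚ + inv (suc (suc q))) * inv (suc (suc q))) →
  W ≤ Λ k n (suc q)
split-≤-Λ k n q {M} {zero} {W} M+0≤n _ _ W≤Me+0 = begin
  W               ≤⟨ W≤Me+0 ⟩
  M · inv k + 0ℚ  ≡⟨ +-identityʳ (M · inv k) ⟩
  M · inv k       ≤⟨ ·-monoˡ-≤ (inv-nonNeg k) (ℕ.m+n≤o⇒m≤o M M+0≤n) ⟩
  n · inv k       ≤⟨ Λ-≥ k n (suc q) ⟩
  Λ k n (suc q)   ∎
  where open ≤-Reasoning
split-≤-Λ k zero q {M} {suc P} M+P≤0 with () ← ℕ.m+n≤o⇒n≤o M M+P≤0
split-≤-Λ k (suc n) q {M} {suc zero} {W} M+1≤n+1 _ _ W≤Me+c = begin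
  W                                       ≤⟨ W≤Me+c ⟩
  M · inv k + ((1ℚ + v) * v + 0ℚ)         ≤⟨ +-mono-≤ (·-monoˡ-≤ (inv-nonNeg k) (ℕ.m+n≤o⇒m≤o∸n M M+1≤n+1))
                                                       c≤1/q ⟩
  n · inv k + inv (suc q)                 ≤⟨ Λ-suc-≥ k n (suc q) ⟩
  Λ k (suc n) (suc q)                     ∎
  where
  open ≤-Reasoning
  v = inv (suc (suc q))
  c≤1/q : (1ℚ + v) * v + 0ℚ ≤ inv (suc q)
  c≤1/q = begin
    (1ℚ + v) * v + 0ℚ              ≡⟨ +-identityʳ _ ⟩
    (1ℚ + v) * v                   ≤⟨ *-monoʳ-≤-nonNeg v {{nonNegative (inv-nonNeg (suc (suc q)))}}
                                        (+-monoʳ-≤ 1ℚ (inv-antimono-≤ (ℕ.n≤1+n q))) ⟩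
    (1ℚ + inv (suc q)) * v         ≡⟨ [1+inv]*inv-suc≡inv q ⟩
    inv (suc q)                    ∎
split-≤-Λ k (suc zero) q {M} {suc (suc P)} M+P≤1 with s≤s () ← ℕ.m+n≤o⇒n≤o M M+P≤1
split-≤-Λ k (suc (suc n)) q {M} {suc (suc P)} {W} {S} M+P≤n S≤1/q W≤Me+ρS _ = begin
  W                                           ≤⟨ W≤Me+ρS ⟩
  M · inv k + ρ * S                           ≤⟨ +-mono-≤ (·-monoˡ-≤ (inv-nonNeg k) M≤n)
                                                   (*-monoˡ-≤-nonNeg ρ {{nonNegative (1+inv-nonNeg (suc (suc q)))}}
                                                     S≤1/q) ⟩
  n · inv k + ρ * inv (suc q)                 ≡⟨ cong (n · inv k +_) ([1+inv-suc]*inv≡inv+inv[*suc] q) ⟩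
  n · inv k + (inv (suc q) + inv (suc q ℕ.* suc (suc q)))  ≤⟨ Λ-2+-≥ k n (suc q) ⟩
  Λ k (suc (suc n)) (suc q)                   ∎
  where
  open ≤-Reasoning
  ρ = 1ℚ + inv (suc (suc q))
  M≤n : M ℕ.≤ n
  M≤n = ℕ.≤-trans (ℕ.m+n≤o⇒m≤o∸n M M+P≤n) (ℕ.m∸n≤m n P)

w₂List-≤-Λ-tiny : ∀ k n q {xs} → All (0ℚ ≤_) xs → All (_≤ inv (suc (suc q))) xs →
  length xs ℕ.≤ n → sumℚ xs ≤ inv (suc q) → w₂List k xs ≤ Λ k n (suc q)
w₂List-≤-Λ-tiny k n q 0≤xs xs≤1/q+1 |xs|≤n S≤1/q =
  let M , P , M+P≡|xs| , W≤Me+ρS , W≤Me+Pc =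
        weight-split (w₂ k) (inv k) ρ (ρ * inv (suc (suc q))) 0≤ρ 0≤xs (All.map item xs≤1/q+1)
  in split-≤-Λ k n q {M} {P} (subst (ℕ._≤ n) (sym M+P≡|xs|) |xs|≤n) S≤1/q W≤Me+ρS W≤Me+Pc
  where
  ρ = 1ℚ + inv (suc (suc q))
  0≤ρ : 0ℚ ≤ ρ
  0≤ρ = 1+inv-nonNeg (suc (suc q))
  item : ∀ {a} → a ≤ inv (suc (suc q)) →
    w₂ k a ≤ inv k ⊎ (w₂ k a ≤ ρ * a × w₂ k a ≤ ρ * inv (suc (suc q)))
  item a≤1/q+1 = ⊔-classify w≤e⊔ρa
    (≤-trans w≤e⊔ρa (⊔-monoʳ-≤ (inv k) (*-monoˡ-≤-nonNeg ρ {{nonNegative 0≤ρ}} a≤1/q+1)))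
    where
    w≤e⊔ρa = w₂-≤-tiny k {suc q} (s≤s z≤n) a≤1/q+1

w₂List-≤-Λ : ∀ k n q → 1 ℕ.≤ q → ∀ {xs} → All (0ℚ ≤_) xs →
  length xs ℕ.≤ n → sumℚ xs ≤ inv (suc q) → w₂List k xs ≤ Λ k n (suc q)
w₂List-≤-Λ k zero q _ {[]} _ _ _ = ≤-refl
w₂List-≤-Λ k (suc n) q q≥1 {xs} 0≤xs |xs|≤n S≤1/q with any? (inv (suc (suc q)) <?_) xs
... | no no-big = w₂List-≤-Λ-tiny k (suc n) q 0≤xs (All.map ≮⇒≥ (¬Any⇒All¬ xs no-big)) |xs|≤n S≤1/q
... | yes big with a , ys , 1/q+1<a , σ ← extract big = begin
    w₂List k xs           ≡⟨ sumℚ-↭ (map⁺ (w₂ k) σ) ⟩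
    w₂ k a + w₂List k ys  ≤⟨ +-mono-≤ (w₂-≤-slot k (s≤s q≥1) 1/q+1<a a≤1/q) IH ⟩
    (inv (suc q) ⊔ inv k) + Λ k n (suc q ℕ.* suc (suc q)) ∎
  where
  open ≤-Reasoning
  0≤a∷ys : All (0ℚ ≤_) (a ∷ ys)
  0≤a∷ys = All-resp-↭ σ 0≤xs
  a+S≤1/q : a + sumℚ ys ≤ inv (suc q)
  a+S≤1/q = subst (_≤ inv (suc q)) (sumℚ-↭ σ) S≤1/q
  a≤1/q : a ≤ inv (suc q)
  a≤1/q = ≤-trans (p≤p+q (sumℚ-nonNeg (All.tail 0≤a∷ys))) a+S≤1/q
  IH : w₂List k ys ≤ Λ k n (suc q ℕ.* suc (suc q))
  IH = w₂List-≤-Λ k n (suc q ℕ.+ q ℕ.* suc (suc q)) (s≤s z≤n) (All.tail 0≤a∷ys)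
         (ℕ.s≤s⁻¹ (subst (ℕ._≤ suc n) (↭-length σ) |xs|≤n))
         (cancel-+-≤ (<⇒≤ 1/q+1<a) (subst (a + sumℚ ys ≤_) (inv-split q) a+S≤1/q))

w₂List-≤-λ-big : ∀ m {xs} → All (0ℚ ≤_) xs → length xs ℕ.≤ suc m → sumℚ xs ≤ 1ℚ →
  Any (inv 2 <_) xs → w₂List (suc m) xs ≤ λ' (suc m) - inv (suc m)
w₂List-≤-λ-big m {xs} 0≤xs |xs|≤k S≤1 big with a , ys , 1/2<a , σ ← extract big = begin
  w₂List k xs                        ≡⟨ sumℚ-↭ (map⁺ (w₂ k) σ) ⟩
  w₂ k a + w₂List k ys               ≡⟨ cong (_+ w₂List k ys) (w₂-big k 1/2<a) ⟩
  (1ℚ - e) + w₂List k ys             ≤⟨ +-mono-≤ (+-monoˡ-≤ (- e) (p≤p⊔q 1ℚ e)) IH ⟩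
  ((1ℚ ⊔ e) - e) + Λ k m 2           ≡⟨ solve 3 (λ x e y → (x :- e) :+ y := (x :+ y) :- e)
                                          refl (1ℚ ⊔ e) e (Λ k m 2) ⟩
  Λ k k 1 - e                        ≡⟨ cong (_- e) (sym (λ'≡Λ k)) ⟩
  λ' k - e                           ∎
  where
  open ≤-Reasoning
  k = suc m
  e = inv k
  0≤a∷ys : All (0ℚ ≤_) (a ∷ ys)
  0≤a∷ys = All-resp-↭ σ 0≤xs
  IH : w₂List k ys ≤ Λ k m 2
  IH = w₂List-≤-Λ k m 1 (s≤s z≤n) (All.tail 0≤a∷ys)
         (ℕ.s≤s⁻¹ (subst (ℕ._≤ k) (↭-length σ) |xs|≤k))
         (cancel-+-≤ (<⇒≤ 1/2<a) (subst₂ _≤_ (sumℚ-↭ σ) refl S≤1))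

Λ-3+-≥ : ∀ k n → (1ℚ + inv 2) + n · inv k ≤ Λ k (3 ℕ.+ n) 1 - inv k
Λ-3+-≥ k n = begin
  (1ℚ + inv 2) + n · e              ≡⟨ solve 4 (λ a b e r → (a :+ b) :+ r := (a :+ (b :+ (e :+ r))) :- e)
                                        refl 1ℚ (inv 2) e (n · e) ⟩
  (1ℚ + (inv 2 + (e + n · e))) - e  ≤⟨ +-monoˡ-≤ (- e) (+-mono-≤ (p≤p⊔q 1ℚ e) (+-mono-≤ (p≤p⊔q (inv 2) e)
                                         (+-mono-≤ (p≤q⊔p (inv 6) e) (Λ-≥ k n 42)))) ⟩
  Λ k (3 ℕ.+ n) 1 - e               ∎
  where
  open ≤-Reasoning
  e = inv k

w₂List-≤-λ-small : ∀ m {xs} → All (0ℚ ≤_) xs → All (λ a → ¬ (inv 2 < a)) xs →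
  length xs ℕ.≤ 3 ℕ.+ m → sumℚ xs ≤ 1ℚ → w₂List (3 ℕ.+ m) xs ≤ λ' (3 ℕ.+ m) - inv (3 ℕ.+ m)
w₂List-≤-λ-small m {xs} 0≤xs xs≤1/2 |xs|≤k S≤1 =
  let M , P , M+P≡|xs| , W≤Me+ρS , W≤Me+Pc =
        weight-split (w₂ k) e (1ℚ + inv 2) (inv 2) (1+inv-nonNeg 2) 0≤xs (All.map item xs≤1/2)
  in begin
    w₂List k xs            ≤⟨ bound M P (subst (ℕ._≤ k) (sym M+P≡|xs|) |xs|≤k) W≤Me+ρS W≤Me+Pc ⟩
    3 · inv 2 + m · e      ≤⟨ Λ-3+-≥ k m ⟩
    Λ k k 1 - e            ≡⟨ cong (_- e) (sym (λ'≡Λ k)) ⟩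
    λ' k - e               ∎
  where
  open ≤-Reasoning
  k = 3 ℕ.+ m
  e = inv k
  item : ∀ {a} → ¬ (inv 2 < a) → w₂ k a ≤ e ⊎ (w₂ k a ≤ (1ℚ + inv 2) * a × w₂ k a ≤ inv 2)
  item a≯1/2 = ⊔-classify (w₂-≤-tiny k {1} (s≤s z≤n) (≮⇒≥ a≯1/2))
                          (p≤q⇒p≤r⊔q e (w₂-≤-half k (s≤s (s≤s z≤n)) a≯1/2))
  bound : ∀ M P → M ℕ.+ P ℕ.≤ k → w₂List k xs ≤ M · e + (1ℚ + inv 2) * sumℚ xs →
    w₂List k xs ≤ M · e + P · inv 2 → w₂List k xs ≤ 3 · inv 2 + m · e
  bound M P M+P≤k W≤Me+ρS W≤Me+Pc with P ℕ.≤? 3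
  ... | yes P≤3 = ≤-trans W≤Me+Pc
    (exchange-≤ 3 m M+P≤k P≤3 (inv-nonNeg k) (inv-antimono-≤ {1} {2 ℕ.+ m} (s≤s z≤n)))
  ... | no  P≰3 = begin
    w₂List k xs                 ≤⟨ W≤Me+ρS ⟩
    M · e + (1ℚ + inv 2) * sumℚ xs  ≤⟨ +-mono-≤ (·-monoˡ-≤ (inv-nonNeg k) M≤m)
                                      (*-monoˡ-≤-nonNeg (1ℚ + inv 2) {{nonNegative (1+inv-nonNeg 2)}} S≤1) ⟩
    m · e + (1ℚ + inv 2) * 1ℚ   ≡⟨ +-comm (m · e) _ ⟩
    3 · inv 2 + m · e           ∎
    where
    M≤m : M ℕ.≤ m
    M≤m = ℕ.≤-trans (ℕ.m+n≤o⇒m≤o∸n M M+P≤k) (ℕ.∸-monoʳ-≤ k (ℕ.<⇒≤ (ℕ.≰⇒> P≰3)))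

lemma3 : (k : ℕ) → 3 Data.Nat.≤ k → (I : List ℚ) →
    All (λ a → (0ℚ < a) × (a ≤ 1ℚ)) I →
    length I Data.Nat.≤ k →
    sumℚ I ≤ 1ℚ →
    w₂List k I ≤ λ' k - inv k
lemma3 (suc (suc (suc m))) (s≤s (s≤s (s≤s _))) I 0<I≤1 |I|≤k ΣI≤1 = by-cases (any? (inv 2 <?_) I)
  where
  0≤I : All (0ℚ ≤_) I
  0≤I = All.map (λ 0<a∧a≤1 → <⇒≤ (proj₁ 0<a∧a≤1)) 0<I≤1
  by-cases : Dec (Any (inv 2 <_) I) → w₂List (3 ℕ.+ m) I ≤ λ' (3 ℕ.+ m) - inv (3 ℕ.+ m)
  by-cases (yes big)    = w₂List-≤-λ-big (2 ℕ.+ m) 0≤I |I|≤k ΣI≤1 big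
  by-cases (no  no-big) = w₂List-≤-λ-small m 0≤I (¬Any⇒All¬ I no-big) |I|≤k ΣI≤1
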